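{- Let $\mathscr{A}$ be the set of overpartitions such that (1) only odd parts may be overlined, and (2) the difference between any two parts is at least $4$, and is at least $5$ if the larger of the two parts is overlined or divisible by $4$. Let $\Pi=\{\pi_1,\ldots,\pi_7\}$ with $\pi_1=\varnothing$, $\pi_2=(1)$, $\pi_3=(\overline{1})$, $\pi_4=(2)$, $\pi_5=(3)$, $\pi_6=(\overline{3})$, $\pi_7=(4)$, and let $\mathcal{L}:\Pi\to P(\Pi)$ be given by $\mathcal{L}(\pi_1)=\Pi$, $\mathcal{L}(\pi_2)=\mathcal{L}(\pi_3)=\{\pi_1,\pi_2,\pi_4,\pi_5,\pi_6,\pi_7\}$, $\mathcal{L}(\pi_4)=\{\pi_1,\pi_4,\pi_5,\pi_6,\pi_7\}$, $\mathcal{L}(\pi_5)=\mathcal{L}(\pi_6)=\{\pi_1,\pi_5,\pi_7\}$, $\mathcal{L}(\pi_7)=\{\pi_1\}$. Then $\mathscr{A}$ equals the span one linked partition ideal $\mathscr{I}(\langle\Pi,\mathcal{L}\rangle,4)$.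
   Context: An overpartition is a partition in which the first occurrence of each distinct part value may be overlined. Given a finite set $\Pi=\{\pi_1,\ldots,\pi_K\}$ of overpartitions with $\pi_1=\varnothing$, a map $\mathcal{L}:\Pi\to P(\Pi)$ (power set) with $\mathcal{L}(\pi_1)=\Pi$ and $\pi_1\in\mathcal{L}(\pi_k)$ for all $k$, and a positive integer $T$ at least the largest part among overpartitions in $\Pi$, the span one linked partition ideal $\mathscr{I}(\langle\Pi,\mathcal{L}\rangle,T)$ is the set consisting of the empty overpartition together with all overpartitions of the form $\lambda=\phi^0(\lambda_0)\oplus\phi^T(\lambda_1)\oplus\cdots\oplus\phi^{NT}(\lambda_N)$ with $N\ge 0$, each $\lambda_i\in\Pi$, $\lambda_i\in\mathcal{L}(\lambda_{i-1})$ for $1\le i\le N$, and $\lambda_N\ne\varnothing$. Here $\mu\oplus\nu$ is the overpartition formed by collecting all parts of $\mu$ and $\nu$, and $\phi^m(\mu)$ is obtained by adding $m$ to each part of $\mu$, preserving overlines. -}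

module Defs where

open import Data.Nat using (ℕ; zero; suc; _+_; _*_; _≤_)
open import Data.Nat.Divisibility using (_∣_)
open import Data.Bool using (Bool; true; false)
open import Data.Fin using (Fin; toℕ; inject₁; fromℕ) renaming (zero to fzero; suc to fsuc)
open import Data.List using (List; []; _∷_; map; concat; length; lookup; allFin)
open import Data.List.Relation.Unary.All using (All)
open import Data.List.Membership.Propositional using (_∈_)
open import Data.List.Relation.Binary.Permutation.Propositional using (_↭_)
open import Data.Product using (_×_; _,_; proj₁; proj₂; Σ; ∃-syntax)
open import Data.Sum using (_⊎_)
open import Relation.Binary.PropositionalEquality using (_≡_; _≢_)
open import Relation.Nullary using (¬_)

-- A part is (value , overlined?) ; true = overlined.
Part : Set
Part = ℕ × Bool

-- An overpartition is a finite multiset of parts, represented by a list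
-- (order irrelevant: equality of overpartitions is _↭_).
OP : Set
OP = List Part

IsOverpartition : OP → Set
IsOverpartition λ′ =
  All (λ p → 1 ≤ proj₁ p) λ′ ×
  (∀ (i j : Fin (length λ′)) → i ≢ j →
     proj₁ (lookup λ′ i) ≡ proj₁ (lookup λ′ j) →
     ¬ (proj₂ (lookup λ′ i) ≡ true × proj₂ (lookup λ′ j) ≡ true))

InA : OP → Set
InA λ′ =
  (∀ (i : Fin (length λ′)) → proj₂ (lookup λ′ i) ≡ true → ¬ (2 ∣ proj₁ (lookup λ′ i))) ×
  (∀ (i j : Fin (length λ′)) → i ≢ j →
     let a = proj₁ (lookup λ′ i)
         b = proj₁ (lookup λ′ j)
     in a ≤ b →
        (a + 4 ≤ b) ×
        ((proj₂ (lookup λ′ j) ≡ true ⊎ 4 ∣ b) → a + 5 ≤ b))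

shift : ℕ → OP → OP
shift m = map (λ p → (m + proj₁ p , proj₂ p))

-- General span one linked partition ideal I(⟨Π,L⟩,T), with Π indexed by Fin K
-- (index fzero is π₁ = ∅) and L given by lists of indices.
InIdeal : (K : ℕ) → (Fin K → OP) → (Fin K → List (Fin K)) → ℕ →
          Fin K → OP → Set
InIdeal K π L T empty λ′ =
  (λ′ ↭ []) ⊎
  (∃[ N ] Σ (Fin (suc N) → Fin K) λ seq →
     (∀ (i : Fin N) → seq (fsuc i) ∈ L (seq (inject₁ i))) ×
     (seq (fromℕ N) ≢ empty) ×
     (λ′ ↭ concat (map (λ i → shift (toℕ i * T) (π (seq i))) (allFin (suc N)))))

-- The specific Π = {π₁,…,π₇} (π_k is index k-1).
π : Fin 7 → OP
π fzero = []
π (fsuc fzero) = (1 , false) ∷ []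
π (fsuc (fsuc fzero)) = (1 , true) ∷ []
π (fsuc (fsuc (fsuc fzero))) = (2 , false) ∷ []
π (fsuc (fsuc (fsuc (fsuc fzero)))) = (3 , false) ∷ []
π (fsuc (fsuc (fsuc (fsuc (fsuc fzero))))) = (3 , true) ∷ []
π (fsuc (fsuc (fsuc (fsuc (fsuc (fsuc fzero)))))) = (4 , false) ∷ []

p1 p2 p3 p4 p5 p6 p7 : Fin 7
p1 = fzero
p2 = fsuc fzero
p3 = fsuc (fsuc fzero)
p4 = fsuc (fsuc (fsuc fzero))
p5 = fsuc (fsuc (fsuc (fsuc fzero)))
p6 = fsuc (fsuc (fsuc (fsuc (fsuc fzero))))
p7 = fsuc (fsuc (fsuc (fsuc (fsuc (fsuc fzero)))))

𝓛 : Fin 7 → List (Fin 7)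
𝓛 fzero = p1 ∷ p2 ∷ p3 ∷ p4 ∷ p5 ∷ p6 ∷ p7 ∷ []
𝓛 (fsuc fzero) = p1 ∷ p2 ∷ p4 ∷ p5 ∷ p6 ∷ p7 ∷ []
𝓛 (fsuc (fsuc fzero)) = p1 ∷ p2 ∷ p4 ∷ p5 ∷ p6 ∷ p7 ∷ []
𝓛 (fsuc (fsuc (fsuc fzero))) = p1 ∷ p4 ∷ p5 ∷ p6 ∷ p7 ∷ []
𝓛 (fsuc (fsuc (fsuc (fsuc fzero)))) = p1 ∷ p5 ∷ p7 ∷ []
𝓛 (fsuc (fsuc (fsuc (fsuc (fsuc fzero))))) = p1 ∷ p5 ∷ p7 ∷ []
𝓛 (fsuc (fsuc (fsuc (fsuc (fsuc (fsuc fzero)))))) = p1 ∷ []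

-- The difference conditions defining 𝒜 are invariant under φ⁴, and two parts at
-- least five apart never violate them.  An element φ⁰(λ₀) ⊕ φ⁴(λ₁) ⊕ ⋯ of the ideal
-- has at most one part in each window [4i+1, 4i+4], so only parts in adjacent windows
-- can be too close, and 𝓛(πₛ) is exactly the set of πₜ for which πₛ ⊕ φ⁴(πₜ) satisfies
-- the conditions.  Conversely an overpartition in 𝒜 has at most one part in [1, 4],
-- which (odd if overlined) is the part of some πₛ; what remains is φ⁴ of an element
-- of 𝒜, and induction on the largest part concludes.

module Submission where

open import Defs
open import Data.Bool using (true; false)
open import Data.Bool.Properties using () renaming (_≟_ to _≟ᵇ_)
open import Data.Empty using (⊥; ⊥-elim)
open import Data.Fin using (Fin; toℕ; inject₁; fromℕ)
  renaming (zero to fzero; suc to fsuc; _≟_ to _≟ᶠ_)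
open import Data.Fin.Properties using (all?; suc-injective)
open import Data.List using (List; []; _∷_; _++_; [_]; map; concat; tabulate; allFin; lookup)
open import Data.List.Properties
  using (map-id; map-∘; map-cong; map-++; map-tabulate; tabulate-cong; concat-map; ++-identityʳ)
open import Data.List.Membership.Propositional using (_∈_)
open import Data.List.Membership.DecPropositional (_≟ᶠ_ {7}) using (_∈?_)
open import Data.List.Relation.Unary.All as All using (All; []; _∷_)
import Data.List.Relation.Unary.All.Properties as All
open import Data.List.Relation.Unary.AllPairs as AllPairs using (AllPairs; []; _∷_; allPairs?)
import Data.List.Relation.Unary.AllPairs.Properties as AllPairs
open import Data.List.Relation.Binary.Permutation.Propositional
  using (_↭_; prep; ↭-refl; ↭-sym; ↭-trans; ↭-reflexive; ↭⇒↭ₛ)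
open import Data.List.Relation.Binary.Permutation.Propositional.Properties
  renaming (shift to ↭-shift)
  using (map⁺; All-resp-↭)
import Data.List.Relation.Binary.Permutation.Setoid.Properties as PermutationSetoid
open import Data.Nat using (ℕ; zero; suc; _+_; _*_; _≤_; _<_; _≤?_; s≤s; z≤n)
open import Data.Nat.Divisibility using (_∣_; _∣?_; divides; ∣-refl; ∣m∣n⇒∣m+n; ∣m+n∣m⇒∣n)
open import Data.Nat.ListAction using (sum)
open import Data.Nat.Properties
  using ( ≤-trans; ≤-total; <-irrefl; ≰⇒>; n≤1+n; m≤m+n; m≤n+m; m≤m*n; m+1+n≰m
        ; +-assoc; +-monoˡ-≤; +-monoʳ-≤; +-cancelˡ-≤; *-monoˡ-≤)
open import Data.Product using (_×_; _,_; proj₁; proj₂; ∃₂; ∃-syntax; swap)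
open import Data.Product.Function.NonDependent.Propositional using (_×-⇔_)
import Data.Sum as Sum
open import Data.Sum using (_⊎_; inj₁; inj₂)
open import Function using (_∘_; id)
open import Function.Bundles using (_⇔_; mk⇔; Equivalence)
open import Relation.Binary.PropositionalEquality
  using (_≡_; _≢_; refl; sym; trans; cong; cong₂; subst; resp₂; setoid; module ≡-Reasoning)
open import Relation.Nullary using (¬_; Dec; does; yes; no; ¬?; _×-dec_; _⊎-dec_; _→-dec_)
open import Relation.Nullary.Decidable using (from-yes)

open Equivalence using (to; from)

shift-0 : ∀ xs → shift 0 xs ≡ xs
shift-0 = map-id

shift-+ : ∀ m n xs → shift (m + n) xs ≡ shift m (shift n xs)
shift-+ m n xs =
  trans (map-cong (λ p → cong (_, proj₂ p) (+-assoc m n (proj₁ p))) xs) (map-∘ xs)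

does-≡⇒⇔ : ∀ {p q} {P : Set p} {Q : Set q} (P? : Dec P) (Q? : Dec Q) →
           does P? ≡ does Q? → P ⇔ Q
does-≡⇒⇔ (yes p) (yes q) _ = mk⇔ (λ _ → q) (λ _ → p)
does-≡⇒⇔ (no ¬p) (no ¬q) _ = mk⇔ (⊥-elim ∘ ¬p) (⊥-elim ∘ ¬q)

module SpanOneIdeal
  {K : ℕ} (Π : Fin K → OP) (L : Fin K → List (Fin K)) (T : ℕ) (empty : Fin K) where

  data ChainSum : Fin K → OP → Set where
    last : ∀ {s} → s ≢ empty → ChainSum s (Π s)
    step : ∀ {s t μ} → t ∈ L s → ChainSum t μ → ChainSum s (Π s ++ shift T μ)

  Generated : OP → Set
  Generated xs = xs ↭ [] ⊎ ∃₂ λ s ν → ChainSum s ν × xs ↭ ν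

  IsChain : (N : ℕ) → (Fin (suc N) → Fin K) → Set
  IsChain N seq = ∀ i → seq (fsuc i) ∈ L (seq (inject₁ i))

  sumOf : (N : ℕ) → (Fin (suc N) → Fin K) → OP
  sumOf N seq = concat (tabulate (λ i → shift (toℕ i * T) (Π (seq i))))

  sumOf-zero : ∀ seq → sumOf 0 seq ≡ Π (seq fzero)
  sumOf-zero seq = trans (++-identityʳ _) (shift-0 _)

  sumOf-suc : ∀ N seq → sumOf (suc N) seq ≡ Π (seq fzero) ++ shift T (sumOf N (seq ∘ fsuc))
  sumOf-suc N seq = cong₂ _++_ (shift-0 _) (begin
      concat (tabulate (λ i → shift (T + toℕ i * T) (Π (seq (fsuc i)))))
    ≡⟨ cong concat (tabulate-cong (λ i → shift-+ T (toℕ i * T) (Π (seq (fsuc i))))) ⟩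
      concat (tabulate (shift T ∘ part))
    ≡⟨ cong concat (map-tabulate part (shift T)) ⟨
      concat (map (shift T) (tabulate part))
    ≡⟨ concat-map (tabulate part) ⟩
      shift T (sumOf N (seq ∘ fsuc)) ∎)
    where
    open ≡-Reasoning
    part : Fin (suc N) → OP
    part i = shift (toℕ i * T) (Π (seq (fsuc i)))

  chainSum-of-chain : ∀ N seq → IsChain N seq → seq (fromℕ N) ≢ empty →
                      ChainSum (seq fzero) (sumOf N seq)
  chainSum-of-chain zero seq _ nonempty = subst (ChainSum _) (sym (sumOf-zero seq)) (last nonempty)
  chainSum-of-chain (suc N) seq chain nonempty =
    subst (ChainSum _) (sym (sumOf-suc N seq))
      (step (chain fzero) (chainSum-of-chain N (seq ∘ fsuc) (chain ∘ fsuc) nonempty))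

  chain-of-chainSum : ∀ {s ν} → ChainSum s ν → ∃₂ λ N seq →
    seq fzero ≡ s × IsChain N seq × seq (fromℕ N) ≢ empty × ν ≡ sumOf N seq
  chain-of-chainSum {s} (last nonempty) =
    0 , (λ _ → s) , refl , (λ ()) , nonempty , sym (sumOf-zero (λ _ → s))
  chain-of-chainSum {s} (step t∈ c) with chain-of-chainSum c
  ... | N , seq , refl , chain , nonempty , refl =
    suc N , seq′ , refl , chain′ , nonempty , sym (sumOf-suc N seq′)
    where
    seq′ : Fin (suc (suc N)) → Fin K
    seq′ fzero = s
    seq′ (fsuc i) = seq i
    chain′ : IsChain (suc N) seq′
    chain′ fzero = t∈
    chain′ (fsuc i) = chain i

  inIdeal⇔generated : ∀ xs → InIdeal K Π L T empty xs ⇔ Generated xs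
  inIdeal⇔generated xs = mk⇔ to′ from′
    where
    sumOf-allFin : ∀ N seq →
      concat (map (λ i → shift (toℕ i * T) (Π (seq i))) (allFin (suc N))) ≡ sumOf N seq
    sumOf-allFin N seq = cong concat (map-tabulate id (λ i → shift (toℕ i * T) (Π (seq i))))

    to′ : InIdeal K Π L T empty xs → Generated xs
    to′ (inj₁ xs↭[]) = inj₁ xs↭[]
    to′ (inj₂ (N , seq , chain , nonempty , xs↭)) =
      inj₂ (_ , _ , chainSum-of-chain N seq chain nonempty ,
            ↭-trans xs↭ (↭-reflexive (sumOf-allFin N seq)))

    from′ : Generated xs → InIdeal K Π L T empty xs
    from′ (inj₁ xs↭[]) = inj₁ xs↭[]
    from′ (inj₂ (_ , _ , c , xs↭ν)) with chain-of-chainSum c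
    ... | N , seq , _ , chain , nonempty , refl =
      inj₂ (N , seq , chain , nonempty , ↭-trans xs↭ν (↭-reflexive (sym (sumOf-allFin N seq))))

module _ {p} {A : Set} {P : A → Set p} where

  All-lookup⁺ : ∀ xs → (∀ i → P (lookup xs i)) → All P xs
  All-lookup⁺ [] _ = []
  All-lookup⁺ (x ∷ xs) h = h fzero ∷ All-lookup⁺ xs (h ∘ fsuc)

  All-lookup⁻ : ∀ {xs} → All P xs → ∀ i → P (lookup xs i)
  All-lookup⁻ (px ∷ _) fzero = px
  All-lookup⁻ (_ ∷ pxs) (fsuc i) = All-lookup⁻ pxs i

module _ {r} {A : Set} {R : A → A → Set r} where

  AllPairs-lookup⁺ : ∀ xs → (∀ i j → i ≢ j → R (lookup xs i) (lookup xs j)) →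
                     AllPairs (λ x y → R x y × R y x) xs
  AllPairs-lookup⁺ [] _ = []
  AllPairs-lookup⁺ (x ∷ xs) h =
    All-lookup⁺ xs (λ j → h fzero (fsuc j) (λ ()) , h (fsuc j) fzero (λ ())) ∷
    AllPairs-lookup⁺ xs (λ i j i≢j → h (fsuc i) (fsuc j) (i≢j ∘ suc-injective))

  AllPairs-lookup⁻ : ∀ {xs} → AllPairs (λ x y → R x y × R y x) xs →
                     ∀ i j → i ≢ j → R (lookup xs i) (lookup xs j)
  AllPairs-lookup⁻ (_ ∷ _) fzero fzero i≢j = ⊥-elim (i≢j refl)
  AllPairs-lookup⁻ (Rx ∷ _) fzero (fsuc j) _ = proj₁ (All-lookup⁻ Rx j)
  AllPairs-lookup⁻ (Rx ∷ _) (fsuc i) fzero _ = proj₂ (All-lookup⁻ Rx i)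
  AllPairs-lookup⁻ (_ ∷ Rxs) (fsuc i) (fsuc j) i≢j = AllPairs-lookup⁻ Rxs i j (i≢j ∘ cong fsuc)

  AllPairs-++⁻ʳ : ∀ xs {ys} → AllPairs R (xs ++ ys) → AllPairs R ys
  AllPairs-++⁻ʳ [] Rys = Rys
  AllPairs-++⁻ʳ (_ ∷ xs) (_ ∷ Rxs) = AllPairs-++⁻ʳ xs Rxs

OddIfOverlined : Part → Set
OddIfOverlined x = proj₂ x ≡ true → ¬ 2 ∣ proj₁ x

GapCondition : Part → Part → Set
GapCondition x y = proj₁ x ≤ proj₁ y →
  proj₁ x + 4 ≤ proj₁ y × (proj₂ y ≡ true ⊎ 4 ∣ proj₁ y → proj₁ x + 5 ≤ proj₁ y)

Compatible : Part → Part → Set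
Compatible x y = GapCondition x y × GapCondition y x

Admissible : OP → Set
Admissible xs = All OddIfOverlined xs × AllPairs Compatible xs

CrossCompatible : OP → OP → Set
CrossCompatible xs ys = All (λ x → All (Compatible x) ys) xs

InA⇔Admissible : ∀ xs → InA xs ⇔ Admissible xs
InA⇔Admissible xs = mk⇔
  (λ (odd , gap) → All-lookup⁺ xs odd , AllPairs-lookup⁺ xs gap)
  (λ (odd , compatible) → All-lookup⁻ odd , AllPairs-lookup⁻ compatible)

Admissible-resp-↭ : ∀ {xs ys} → xs ↭ ys → Admissible xs → Admissible ys
Admissible-resp-↭ xs↭ys (odd , compatible) =
  All-resp-↭ xs↭ys odd ,
  PermutationSetoid.AllPairs-resp-↭ (setoid Part) swap (resp₂ Compatible) (↭⇒↭ₛ xs↭ys) compatible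

oddIfOverlined? : ∀ x → Dec (OddIfOverlined x)
oddIfOverlined? x = proj₂ x ≟ᵇ true →-dec ¬? (2 ∣? proj₁ x)

gapCondition? : ∀ x y → Dec (GapCondition x y)
gapCondition? x y = proj₁ x ≤? proj₁ y →-dec
  proj₁ x + 4 ≤? proj₁ y ×-dec ((proj₂ y ≟ᵇ true ⊎-dec 4 ∣? proj₁ y) →-dec proj₁ x + 5 ≤? proj₁ y)

compatible? : ∀ x y → Dec (Compatible x y)
compatible? x y = gapCondition? x y ×-dec gapCondition? y x

admissible? : ∀ xs → Dec (Admissible xs)
admissible? xs = All.all? oddIfOverlined? xs ×-dec allPairs? compatible? xs

crossCompatible? : ∀ xs ys → Dec (CrossCompatible xs ys)
crossCompatible? xs ys = All.all? (λ x → All.all? (compatible? x) ys) xs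

-- shift 4 is definitionally map φ⁴.
φ⁴ : Part → Part
φ⁴ (a , o) = 4 + a , o

oddIfOverlined-φ⁴ : ∀ x → OddIfOverlined x ⇔ OddIfOverlined (φ⁴ x)
oddIfOverlined-φ⁴ x = mk⇔
  (λ odd o 2∣4+a → odd o (∣m+n∣m⇒∣n 2∣4+a (divides 2 refl)))
  (λ odd o 2∣a → odd o (∣m∣n⇒∣m+n (divides 2 refl) 2∣a))

gapCondition-φ⁴ : ∀ x y → GapCondition x y ⇔ GapCondition (φ⁴ x) (φ⁴ y)
gapCondition-φ⁴ x@(a , _) y@(b , _) = mk⇔ shifted unshifted
  where
  shifted : GapCondition x y → GapCondition (φ⁴ x) (φ⁴ y)
  shifted gap 4+a≤4+b with gap (+-cancelˡ-≤ 4 a b 4+a≤4+b)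
  ... | a+4≤b , far =
    +-monoʳ-≤ 4 a+4≤b ,
    λ c → +-monoʳ-≤ 4 (far (Sum.map₂ (λ 4∣4+b → ∣m+n∣m⇒∣n 4∣4+b ∣-refl) c))

  unshifted : GapCondition (φ⁴ x) (φ⁴ y) → GapCondition x y
  unshifted gap a≤b with gap (+-monoʳ-≤ 4 a≤b)
  ... | a+4≤b , far =
    +-cancelˡ-≤ 4 _ _ a+4≤b ,
    λ c → +-cancelˡ-≤ 4 _ _ (far (Sum.map₂ (∣m∣n⇒∣m+n ∣-refl) c))

compatible-φ⁴ : ∀ x y → Compatible x y ⇔ Compatible (φ⁴ x) (φ⁴ y)
compatible-φ⁴ x y = gapCondition-φ⁴ x y ×-⇔ gapCondition-φ⁴ y x

admissible-shift4 : ∀ xs → Admissible xs ⇔ Admissible (shift 4 xs)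
admissible-shift4 xs = mk⇔
  (λ (odd , compatible) →
    All.map⁺ (All.map (to (oddIfOverlined-φ⁴ _)) odd) ,
    AllPairs.map⁺ (AllPairs.map (to (compatible-φ⁴ _ _)) compatible))
  (λ (odd , compatible) →
    All.map (from (oddIfOverlined-φ⁴ _)) (All.map⁻ odd) ,
    AllPairs.map (from (compatible-φ⁴ _ _)) (AllPairs.map⁻ compatible))

Positive : Part → Set
Positive x = 1 ≤ proj₁ x

InRange : ℕ → Part → Set
InRange k x = 1 ≤ proj₁ x × proj₁ x ≤ k * 4

π-inRange : ∀ s → All (InRange 1) (π s)
π-inRange = from-yes (all? λ s → All.all? (λ x → 1 ≤? proj₁ x ×-dec proj₁ x ≤? 4) (π s))

π-admissible : ∀ s → Admissible (π s)
π-admissible = from-yes (all? (admissible? ∘ π))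

-- Checked by evaluating both decision procedures on all 49 pairs (s , t).
𝓛-spec : ∀ s t → t ∈ 𝓛 s ⇔ CrossCompatible (π s) (shift 4 (π t))
𝓛-spec s t = does-≡⇒⇔ (t ∈? 𝓛 s) (linked? s t) (from-yes (all? λ s → all? λ t →
  does (t ∈? 𝓛 s) ≟ᵇ does (linked? s t)) s t)
  where
  linked? : ∀ s t → Dec (CrossCompatible (π s) (shift 4 (π t)))
  linked? s t = crossCompatible? (π s) (shift 4 (π t))

𝓛-∅ : ∀ t → t ∈ 𝓛 p1
𝓛-∅ t = from (𝓛-spec p1 t) []

open SpanOneIdeal π 𝓛 4 p1

compatible-apart : ∀ {x y} → proj₁ x + 5 ≤ proj₁ y → Compatible x y
compatible-apart {a , _} {b , _} a+5≤b =
  (λ _ → ≤-trans (+-monoʳ-≤ a (n≤1+n 4)) a+5≤b , λ _ → a+5≤b) ,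
  (λ b≤a → ⊥-elim (m+1+n≰m a (≤-trans a+5≤b b≤a)))

crossCompatible-far : ∀ {xs ys} → All (InRange 1) xs → All Positive ys →
                      CrossCompatible xs (shift 4 (shift 4 ys))
crossCompatible-far xs-low ys-pos =
  All.map (λ (_ , a≤4) → All.map⁺ (All.map⁺ (All.map (λ 1≤c →
    compatible-apart (≤-trans (+-monoˡ-≤ 5 a≤4) (+-monoʳ-≤ 8 1≤c))) ys-pos))) xs-low

chainSum-positive : ∀ {s ν} → ChainSum s ν → All Positive ν
chainSum-positive {s} (last _) = All.map proj₁ (π-inRange s)
chainSum-positive {s} (step _ c) =
  All.++⁺ (All.map proj₁ (π-inRange s))
          (All.map⁺ (All.map (λ _ → s≤s z≤n) (chainSum-positive c)))

chainSum-linkedBelow : ∀ {s t μ} → t ∈ 𝓛 s → ChainSum t μ →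
                       CrossCompatible (π s) (shift 4 μ)
chainSum-linkedBelow t∈ (last _) = to (𝓛-spec _ _) t∈
chainSum-linkedBelow {s} {t} t∈ (step {μ = μ} _ c) =
  subst (CrossCompatible (π s)) (sym (map-++ φ⁴ (π t) (shift 4 μ)))
    (All.zipWith (λ (near , far) → All.++⁺ near far)
      (to (𝓛-spec s t) t∈ , crossCompatible-far (π-inRange s) (chainSum-positive c)))

chainSum-admissible : ∀ {s ν} → ChainSum s ν → Admissible ν
chainSum-admissible {s} (last _) = π-admissible s
chainSum-admissible {s} (step t∈ c) with to (admissible-shift4 _) (chainSum-admissible c)
... | odd , compatible =
  All.++⁺ (proj₁ (π-admissible s)) odd ,
  AllPairs.++⁺ (proj₂ (π-admissible s)) compatible (chainSum-linkedBelow t∈ c)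

generated-admissible : ∀ {xs} → Generated xs → Admissible xs
generated-admissible (inj₁ xs↭[]) = Admissible-resp-↭ (↭-sym xs↭[]) ([] , [])
generated-admissible (inj₂ (_ , _ , c , xs↭ν)) =
  Admissible-resp-↭ (↭-sym xs↭ν) (chainSum-admissible c)

lowOrShifted : ∀ k x → InRange (suc k) x → InRange 1 x ⊎ ∃[ y ] x ≡ φ⁴ y × InRange k y
lowOrShifted k (a , o) (1≤a , a≤) with a ≤? 4
... | yes a≤4 = inj₁ (1≤a , a≤4)
... | no a≰4 = inj₂ (peel (≰⇒> a≰4) a≤)
  where
  peel : ∀ {a} → 4 < a → a ≤ 4 + k * 4 → ∃[ y ] (a , o) ≡ φ⁴ y × InRange k y
  peel (s≤s (s≤s (s≤s (s≤s (s≤s {n = b} _))))) (s≤s (s≤s (s≤s (s≤s b<)))) =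
    (suc b , o) , refl , s≤s z≤n , b<

splitLow : ∀ k xs → All (InRange (suc k)) xs →
           ∃₂ λ lows ρ → xs ↭ lows ++ shift 4 ρ × All (InRange 1) lows × All (InRange k) ρ
splitLow k [] [] = [] , [] , ↭-refl , [] , []
splitLow k (x ∷ xs) (x-in ∷ xs-in) with splitLow k xs xs-in | lowOrShifted k x x-in
... | lows , ρ , xs↭ , lows-in , ρ-in | inj₁ x-low =
  x ∷ lows , ρ , prep x xs↭ , x-low ∷ lows-in , ρ-in
... | lows , ρ , xs↭ , lows-in , ρ-in | inj₂ (y , refl , y-in) =
  lows , y ∷ ρ , ↭-trans (prep _ xs↭) (↭-sym (↭-shift _ lows (shift 4 ρ))) , lows-in , y-in ∷ ρ-in

low-incompatible : ∀ {x y} → InRange 1 x → InRange 1 y → ¬ Compatible x y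
low-incompatible {a , _} {b , _} (1≤a , a≤4) (1≤b , b≤4) (gapxy , gapyx) =
  Sum.[ (λ a≤b → tooClose 1≤a b≤4 (proj₁ (gapxy a≤b)))
      , (λ b≤a → tooClose 1≤b a≤4 (proj₁ (gapyx b≤a))) ] (≤-total a b)
  where
  tooClose : ∀ {m n} → 1 ≤ m → n ≤ 4 → m + 4 ≤ n → ⊥
  tooClose 1≤m n≤4 m+4≤n = <-irrefl refl (≤-trans (+-monoˡ-≤ 4 1≤m) (≤-trans m+4≤n n≤4))

lowPart-index : ∀ x → InRange 1 x → OddIfOverlined x → ∃[ s ] s ≢ p1 × [ x ] ≡ π s
lowPart-index (0 , _) (() , _) _
lowPart-index (1 , false) _ _ = p2 , (λ ()) , refl
lowPart-index (1 , true) _ _ = p3 , (λ ()) , refl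
lowPart-index (2 , false) _ _ = p4 , (λ ()) , refl
lowPart-index (2 , true) _ odd = ⊥-elim (odd refl ∣-refl)
lowPart-index (3 , false) _ _ = p5 , (λ ()) , refl
lowPart-index (3 , true) _ _ = p6 , (λ ()) , refl
lowPart-index (4 , false) _ _ = p7 , (λ ()) , refl
lowPart-index (4 , true) _ odd = ⊥-elim (odd refl (divides 2 refl))
lowPart-index (suc (suc (suc (suc (suc _)))) , _) (_ , s≤s (s≤s (s≤s (s≤s ())))) _

crossCompatible-head : ∀ {xs t ν} → CrossCompatible xs (shift 4 ν) → ChainSum t ν →
                       CrossCompatible xs (shift 4 (π t))
crossCompatible-head cc (last _) = cc
crossCompatible-head cc (step {s = t} {μ = μ} _ _) =
  All.map (All.++⁻ˡ (shift 4 (π t)) ∘ subst (All _) (map-++ φ⁴ (π t) (shift 4 μ))) cc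

attachLow : ∀ {xs ρ} lows → All (InRange 1) lows → Admissible (lows ++ shift 4 ρ) →
            xs ↭ lows ++ shift 4 ρ → Generated ρ → Generated xs
attachLow [] _ _ xs↭ (inj₁ ρ↭[]) = inj₁ (↭-trans xs↭ (map⁺ φ⁴ ρ↭[]))
attachLow [] _ _ xs↭ (inj₂ (t , ν , c , ρ↭ν)) =
  inj₂ (p1 , shift 4 ν , step (𝓛-∅ t) c , ↭-trans xs↭ (map⁺ φ⁴ ρ↭ν))
attachLow (x ∷ []) (x-low ∷ []) (odd ∷ _ , compatible ∷ _) xs↭ gen
  with lowPart-index x x-low odd
... | s , s≢p1 , [x]≡πs with gen
...   | inj₁ ρ↭[] =
  inj₂ (s , π s , last s≢p1 ,
        ↭-trans xs↭ (↭-trans (prep x (map⁺ φ⁴ ρ↭[])) (↭-reflexive [x]≡πs)))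
...   | inj₂ (t , ν , c , ρ↭ν) =
  inj₂ (s , π s ++ shift 4 ν , step t∈ c ,
        ↭-trans xs↭ (↭-trans (prep x (map⁺ φ⁴ ρ↭ν))
                               (↭-reflexive (cong (_++ shift 4 ν) [x]≡πs))))
  where
  t∈ : t ∈ 𝓛 s
  t∈ = from (𝓛-spec s t)
    (crossCompatible-head (subst (λ xs → CrossCompatible xs (shift 4 ν)) [x]≡πs
      (All-resp-↭ (map⁺ φ⁴ ρ↭ν) compatible ∷ [])) c)
attachLow (x ∷ y ∷ _) (x-low ∷ y-low ∷ _) (_ , (xy ∷ _) ∷ _) _ _ =
  ⊥-elim (low-incompatible x-low y-low xy)

admissible-generated : ∀ k xs → All (InRange k) xs → Admissible xs → Generated xs
admissible-generated zero [] [] _ = inj₁ ↭-refl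
admissible-generated zero (_ ∷ _) ((s≤s _ , ()) ∷ _) _
admissible-generated (suc k) xs xs-in adm with splitLow k xs xs-in
... | lows , ρ , xs↭ , lows-in , ρ-in =
  attachLow lows lows-in adm′ xs↭ (admissible-generated k ρ ρ-in ρ-adm)
  where
  adm′ : Admissible (lows ++ shift 4 ρ)
  adm′ = Admissible-resp-↭ xs↭ adm
  ρ-adm : Admissible ρ
  ρ-adm = from (admissible-shift4 ρ)
    (All.++⁻ʳ lows (proj₁ adm′) , AllPairs-++⁻ʳ lows (proj₂ adm′))

size : OP → ℕ
size xs = sum (map proj₁ xs)

inRange-size : ∀ xs → All Positive xs → All (InRange (size xs)) xs
inRange-size [] [] = []
inRange-size (x ∷ xs) (1≤x ∷ pos) =
  (1≤x , ≤-trans (m≤m+n (proj₁ x) _) (m≤m*n _ 4)) ∷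
  All.map (λ (1≤y , y≤) → 1≤y , ≤-trans y≤ (*-monoˡ-≤ 4 (m≤n+m _ (proj₁ x)))) (inRange-size xs pos)

lemma4p2 : (λ′ : OP) → IsOverpartition λ′ → (InA λ′ ⇔ InIdeal 7 π 𝓛 4 p1 λ′)
lemma4p2 λ′ (positive , _) = mk⇔
  (λ a → from (inIdeal⇔generated λ′)
    (admissible-generated (size λ′) λ′ (inRange-size λ′ positive) (to (InA⇔Admissible λ′) a)))
  (λ i → from (InA⇔Admissible λ′) (generated-admissible (to (inIdeal⇔generated λ′) i)))
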